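{- Let $(\mathcal{P}_i)_{i\in\mathbb{Z}}$ be a stable partition. Then for every matched edge $(I,J)\in E$ there exists $i$ such that $J\in\mathcal{P}_{i-1}$ and $I\in\mathcal{P}_i$.
   Context: Setting: $L\ge1$, $X=Y$ is a string of length $L$ over $\Sigma$, and $E_0=\{(i_1,j_1),\dots,(i_M,j_M)\}\subseteq[L]^2$ with $i_t>j_t$, $X[i_t]=Y[j_t]$, $i_1<\dots<i_M$, $j_1<\dots<j_M$. Extend $X,Y$ to $\mathbb{Z}$ by $X[i]=Y[i]=X[L]$ for $i>L$ and $X[i]=Y[i]=X[1]$ for $i<1$; matched edges are $E=E_0\cup\{(i,i-1): i>L\text{ or } i\le1\}$ (non-intersecting, each edge $(I,J)$ has $I>J$). A segment $[l..r]$ is stable if for every $(I,J)\in E$ exactly one holds: ($J<l$ and $I\le r$) or ($J\ge l$ and $I>r$). A stable partition is a partition of $\mathbb{Z}$ into consecutive segments $\mathcal{P}_i=[p_i..p_{i+1}-1]$, $p_i<p_{i+1}$ ($i\in\mathbb{Z}$), each of which is a stable segment. -}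

module Defs where

open import Data.Nat as ℕ using (ℕ; suc; _<?_)
open import Data.Fin as Fin using (Fin; fromℕ<; fromℕ)
open import Data.Integer using (ℤ; +_; -[1+_]; +[1+_]; _<_; _≤_; _≥_; _>_; _-_; _+_; 1ℤ)
open import Data.Product using (Σ; ∃; _×_)
open import Data.Sum using (_⊎_)
open import Relation.Nullary using (¬_; yes; no)
open import Relation.Binary.PropositionalEquality using (_≡_)

-- Position 1 (1-indexed) corresponds to Fin index 0; positions < 1 go to
-- index 0 (X[1]), positions > L go to the last index (X[L]).
clamp : (n : ℕ) → ℤ → Fin (suc n)
clamp n (+ 0) = Fin.zero
clamp n +[1+ k ] with k <? suc n
... | yes k<L = fromℕ< k<L
... | no _ = fromℕ n
clamp n -[1+ _ ] = Fin.zero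

ext : {A : Set} (n : ℕ) → (Fin (suc n) → A) → ℤ → A
ext n X z = X (clamp n z)

InE : (L M : ℕ) (i j : Fin M → ℤ) → ℤ → ℤ → Set
InE L M i j I J =
  (∃ λ t → I ≡ i t × J ≡ j t) ⊎ ((I > + L ⊎ I ≤ + 1) × J ≡ I - 1ℤ)

Stable : (L M : ℕ) (i j : Fin M → ℤ) → ℤ → ℤ → Set
Stable L M i j l r = ∀ I J → InE L M i j I J →
  ((J < l × I ≤ r) × ¬ (J ≥ l × I > r)) ⊎ (¬ (J < l × I ≤ r) × (J ≥ l × I > r))

record StablePartition (L M : ℕ) (i j : Fin M → ℤ) (p : ℤ → ℤ) : Set where
  field
    increasing : ∀ k → p k < p (k + 1ℤ)
    covers     : ∀ x → ∃ λ k → p k ≤ x × x < p (k + 1ℤ)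
    stable     : ∀ k → Stable L M i j (p k) (p (k + 1ℤ) - 1ℤ)

InSeg : (p : ℤ → ℤ) → ℤ → ℤ → Set
InSeg p k x = p k ≤ x × x < p (k + 1ℤ)

-- An edge (I, J) has I in some part P_k.  Stability of P_k, whose right end
-- is at least I, forces J to lie left of P_k; stability of P_{k-1}, whose
-- right end is below I, forces J to lie in or right of P_{k-1}.
module Submission where

open import Defs
open import Data.Nat using (ℕ; suc)
open import Data.Fin using (Fin) renaming (_<_ to _<ᶠ_)
open import Data.Integer using (ℤ; +_; _+_; _<_; _≤_; _-_; 1ℤ; -1ℤ; pred)
open import Data.Integer.Properties
  using (+-comm; +-assoc; +-identityʳ; <⇒≱; i<j⇒i≤pred[j]; i≤pred[j]⇒i<j; pred-mono)
open import Data.Product using (∃; _×_; _,_)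
open import Data.Sum using (inj₁; inj₂)
open import Data.Empty using (⊥-elim)
open import Relation.Binary.PropositionalEquality using (_≡_; cong; sym; trans; subst)

private
  variable
    L M : ℕ
    i j : Fin M → ℤ
    l r x y I J : ℤ

x-1≡pred[x] : ∀ x → x - 1ℤ ≡ pred x
x-1≡pred[x] x = +-comm x -1ℤ

x-1+1≡x : ∀ x → x - 1ℤ + 1ℤ ≡ x
x-1+1≡x x = trans (+-assoc x -1ℤ 1ℤ) (+-identityʳ x)

x<y⇒x≤y-1 : x < y → x ≤ y - 1ℤ
x<y⇒x≤y-1 {x} {y} x<y = subst (x ≤_) (sym (x-1≡pred[x] y)) (i<j⇒i≤pred[j] x<y)

x≤y⇒x-1<y : x ≤ y → x - 1ℤ < y
x≤y⇒x-1<y {x} {y} x≤y =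
  subst (_< y) (sym (x-1≡pred[x] x)) (i≤pred[j]⇒i<j (pred-mono x≤y))

I≤r⇒J<l : Stable L M i j l r → InE L M i j I J → I ≤ r → J < l
I≤r⇒J<l stable e I≤r with stable _ _ e
... | inj₁ ((J<l , _) , _) = J<l
... | inj₂ (_ , (_ , r<I)) = ⊥-elim (<⇒≱ r<I I≤r)

r<I⇒l≤J : Stable L M i j l r → InE L M i j I J → r < I → l ≤ J
r<I⇒l≤J stable e r<I with stable _ _ e
... | inj₁ ((_ , I≤r) , _) = ⊥-elim (<⇒≱ r<I I≤r)
... | inj₂ (_ , (l≤J , _)) = l≤J

proposition4p6 : (A : Set) (n : ℕ) (X : Fin (suc n) → A)
    (M : ℕ) (i j : Fin M → ℤ) →
    (∀ t → + 1 ≤ i t × i t ≤ + suc n) →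
    (∀ t → + 1 ≤ j t × j t ≤ + suc n) →
    (∀ t → j t < i t) →
    (∀ t → ext n X (i t) ≡ ext n X (j t)) →
    (∀ s t → s <ᶠ t → i s < i t) →
    (∀ s t → s <ᶠ t → j s < j t) →
    (p : ℤ → ℤ) → StablePartition (suc n) M i j p →
    ∀ I J → InE (suc n) M i j I J →
    ∃ λ k → InSeg p (k - 1ℤ) J × InSeg p k I
proposition4p6 _ _ _ _ _ _ _ _ _ _ _ _ p P I J e with StablePartition.covers P I
... | k , I∈Pₖ@(pₖ≤I , I<pₖ₊₁) = k , (pₖ₋₁≤J , J<pₖ) , I∈Pₖ
  where
  open StablePartition P

  pₖ₋₁₊₁≡pₖ : p (k - 1ℤ + 1ℤ) ≡ p k
  pₖ₋₁₊₁≡pₖ = cong p (x-1+1≡x k)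

  J<pₖ : J < p (k - 1ℤ + 1ℤ)
  J<pₖ = subst (J <_) (sym pₖ₋₁₊₁≡pₖ) (I≤r⇒J<l (stable k) e (x<y⇒x≤y-1 I<pₖ₊₁))

  pₖ₋₁≤J : p (k - 1ℤ) ≤ J
  pₖ₋₁≤J = r<I⇒l≤J (stable (k - 1ℤ)) e
    (x≤y⇒x-1<y (subst (_≤ I) (sym pₖ₋₁₊₁≡pₖ) pₖ≤I))
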